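{- As formal power series in $z,t$, $$\sum_{m\ge0}\sum_{k\ge0}T_{5\times m}(2,k)z^mt^k=\frac{1-zt-z^2t^2}{1-z-zt-3z^2t-4z^2t^2-z^3t^2+3z^3t^3+3z^4t^4}.$$
   Context: $T_{n\times m}(s,k)$ denotes the number of tilings of an $n\times m$ rectangle (width $n$, length $m$, unit grid) by exactly $k$ non-overlapping grid-aligned $s\times s$ squares and $nm-ks^2$ unit squares, with rotations/reflections counted as distinct; for $m=0$ the only tiling is the empty one with $k=0$. -}

module Defs where

open import Data.Bool using (Bool; true; false; _∧_; _∨_; not; if_then_else_)
open import Data.Nat using (ℕ; zero; suc; _+_; _∸_; _≤ᵇ_; _<ᵇ_; _≡ᵇ_; ∣_-_∣)
open import Data.Integer using (ℤ; +_; -[1+_]) renaming (_+_ to _+ℤ_; _*_ to _*ℤ_)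
open import Data.List using (List; []; _∷_; map; concatMap; filter; length; upTo; _++_)
open import Data.Product using (_×_; _,_)
open import Relation.Nullary.Decidable using (T?)
open import Data.Bool using (T)

allB : {A : Set} → (A → Bool) → List A → Bool
allB p []       = true
allB p (x ∷ xs) = p x ∧ allB p xs

-- Placement of an s×s square: its corner cell (i , j), with
-- 0 ≤ i < n (across the width) and 0 ≤ j < m (along the length).
Pos : Set
Pos = ℕ × ℕ

cells : ℕ → ℕ → List Pos
cells n m = concatMap (λ i → map (λ j → (i , j)) (upTo m)) (upTo n)

-- all sub-lists (= subsets, each exactly once, of a duplicate-free list)
sublists : {A : Set} → List A → List (List A)
sublists []       = [] ∷ []
sublists (x ∷ xs) = let r = sublists xs in map (x ∷_) r ++ r

fits : ℕ → ℕ → ℕ → Pos → Bool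
fits n m s (i , j) = (i + s ≤ᵇ n) ∧ (j + s ≤ᵇ m)

overlaps : ℕ → Pos → Pos → Bool
overlaps s (i , j) (i' , j') = (∣ i - i' ∣ <ᵇ s) ∧ (∣ j - j' ∣ <ᵇ s)

disjoint : ℕ → List Pos → Bool
disjoint s []       = true
disjoint s (p ∷ ps) = allB (λ q → not (overlaps s p q)) ps ∧ disjoint s ps

-- a set of placements is a valid family of s×s tiles in the n×m rectangle;
-- the remaining cells are covered (uniquely) by unit squares.
validPlacement : ℕ → ℕ → ℕ → List Pos → Bool
validPlacement n m s ps = allB (fits n m s) ps ∧ disjoint s ps

Tcount : ℕ → ℕ → ℕ → ℕ → ℕ
Tcount n m s k =
  length (filter (λ ps → T? (validPlacement n m s ps ∧ (length ps ≡ᵇ k)))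
                 (sublists (cells n m)))

-- Formal power series in z,t with integer coefficients:
-- coefficient of z^a t^b.
PS : Set
PS = ℕ → ℕ → ℤ

sumTo : ℕ → (ℕ → ℤ) → ℤ
sumTo zero    f = f zero
sumTo (suc n) f = sumTo n f +ℤ f (suc n)

_⊛_ : PS → PS → PS
(f ⊛ g) m k = sumTo m (λ a → sumTo k (λ b → f a b *ℤ g (m ∸ a) (k ∸ b)))

-- polynomial given by a list of monomials ((a , b) , c) meaning c z^a t^b
poly : List ((ℕ × ℕ) × ℤ) → PS
poly []                   m k = + 0
poly (((a , b) , c) ∷ cs) m k =
  (if (a ≡ᵇ m) ∧ (b ≡ᵇ k) then c else + 0) +ℤ poly cs m k

F52 : PS
F52 m k = + Tcount 5 m 2 k

numer : PS
numer = poly (((0 , 0) , + 1) ∷ ((1 , 1) , -[1+ 0 ]) ∷ ((2 , 2) , -[1+ 0 ]) ∷ [])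

denom : PS
denom = poly (((0 , 0) , + 1) ∷ ((1 , 0) , -[1+ 0 ]) ∷ ((1 , 1) , -[1+ 0 ])
            ∷ ((2 , 1) , -[1+ 2 ]) ∷ ((2 , 2) , -[1+ 3 ]) ∷ ((3 , 2) , -[1+ 0 ])
            ∷ ((3 , 3) , + 3) ∷ ((4 , 4) , + 3) ∷ [])

-- Build a placement of 2 × 2 squares column by column. Whether a corner in the next column is still
-- usable depends only on the squares with a corner in the current column, so T_{5×m}(2,k) obeys a
-- transfer recursion over the 2⁴ subsets of free corners of a column, each placed square contributing
-- a factor t. Unfolding the recursion symbolically expresses the transfer sequences of lengths
-- m+1, …, m+5 as ℤ[t]-combinations of the 16 state sequences of length m+1; the denominator applied
-- to these combinations is the zero combination, a finite computation. So the product of the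
-- denominator with the series vanishes in z-degrees ≥ 5, and the lower coefficients are computed.

module Submission where

open import Defs
open import Algebra.Bundles using (CommutativeMonoid)
import Algebra.Properties.CommutativeSemigroup as CommutativeSemigroupProperties
open import Data.Bool using (Bool; true; false; _∧_; not; if_then_else_; T)
open import Data.Bool.Properties
  using (∧-zeroʳ; ∧-identityʳ; ∧-conicalˡ; ∧-conicalʳ; if-eta; if-float; if-∧; T-≡; ∧-commutativeMonoid)
open import Data.Bool.Solver using (module ∨-∧-Solver)
open import Data.Fin using (Fin; toℕ)
open import Data.Fin.Properties using (all?)
open import Data.Integer using (ℤ; +_; -[1+_]; _≟_) renaming (_+_ to _+ℤ_; _*_ to _*ℤ_)
import Data.Integer.Properties as ℤ
open import Data.List using (List; []; _∷_; map; filter; length; _++_; upTo; applyUpTo; concat; concatMap)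
open import Data.List.Properties using (length-++; filter-++; length-map; map-concatMap; map-cong)
open import Data.List.Relation.Binary.Permutation.Propositional
  using (_↭_; refl; prep; swap; trans; ↭-refl; ↭-prep; ↭-trans; ↭-reflexive)
open import Data.List.Relation.Binary.Permutation.Propositional.Properties using (↭-length; ++⁺ˡ; shifts)
open import Data.List.Relation.Unary.All as All using (All; []; _∷_)
open import Data.Nat
  using (ℕ; zero; suc; _+_; _∸_; _<_; _≤_; _≤?_; _≤ᵇ_; _<ᵇ_; _≡ᵇ_; ∣_-_∣; s≤s; s≤s⁻¹)
open import Data.Nat.Properties
  using (+-commutativeSemigroup; ∣-∣-comm; ≤ᵇ⇒≤; ≤⇒≤ᵇ; +-comm; +-suc; ≤-trans; m≤m+n; +-∸-comm)
open import Data.Product using (_×_; _,_; proj₁; proj₂)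
open import Data.Unit using (tt)
open import Data.Vec using (Vec; []; _∷_; replicate)
open import Function using (_∘_)
open import Function.Bundles using (Equivalence)
open import Relation.Nullary.Decidable using (Dec; T?; from-yes)
open import Relation.Binary.PropositionalEquality as ≡
  using (_≡_; cong; cong₂; sym; subst; _≗_; module ≡-Reasoning)
open ≡-Reasoning

open CommutativeSemigroupProperties +-commutativeSemigroup
  using () renaming (interchange to +-interchange)
open CommutativeSemigroupProperties ℤ.+-commutativeSemigroup
  using () renaming (interchange to +ℤ-interchange)
open CommutativeSemigroupProperties (CommutativeMonoid.commutativeSemigroup ∧-commutativeMonoid)
  using () renaming (interchange to ∧-interchange; x∙yz≈y∙xz to ∧-swap)

private
  variable
    A B C : Set


countSubsets : (List A → Bool) → List A → ℕ
countSubsets P []       = if P [] then 1 else 0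
countSubsets P (x ∷ xs) = countSubsets (P ∘ (x ∷_)) xs + countSubsets P xs

length-filter-map : (P : B → Bool) (f : A → B) (xs : List A) →
                    length (filter (T? ∘ P) (map f xs)) ≡ length (filter (T? ∘ P ∘ f) xs)
length-filter-map P f []       = ≡.refl
length-filter-map P f (x ∷ xs) with P (f x)
... | true  = cong suc (length-filter-map P f xs)
... | false = length-filter-map P f xs

length-filter-sublists : (P : List A → Bool) (xs : List A) →
                         length (filter (T? ∘ P) (sublists xs)) ≡ countSubsets P xs
length-filter-sublists P [] with P []
... | true  = ≡.refl
... | false = ≡.refl
length-filter-sublists P (x ∷ xs) = begin
  length (filter (T? ∘ P) (map (x ∷_) (sublists xs) ++ sublists xs))
    ≡⟨ cong length (filter-++ (T? ∘ P) (map (x ∷_) (sublists xs)) (sublists xs)) ⟩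
  length (filter (T? ∘ P) (map (x ∷_) (sublists xs)) ++ filter (T? ∘ P) (sublists xs))
    ≡⟨ length-++ (filter (T? ∘ P) (map (x ∷_) (sublists xs))) ⟩
  length (filter (T? ∘ P) (map (x ∷_) (sublists xs))) + length (filter (T? ∘ P) (sublists xs))
    ≡⟨ cong₂ _+_ (≡.trans (length-filter-map P (x ∷_) (sublists xs)) (length-filter-sublists (P ∘ (x ∷_)) xs))
                 (length-filter-sublists P xs) ⟩
  countSubsets P (x ∷ xs) ∎

countSubsets-cong : {P Q : List A → Bool} → P ≗ Q → countSubsets P ≗ countSubsets Q
countSubsets-cong P≗Q []       = cong (λ b → if b then 1 else 0) (P≗Q [])
countSubsets-cong P≗Q (x ∷ xs) = cong₂ _+_ (countSubsets-cong (P≗Q ∘ (x ∷_)) xs) (countSubsets-cong P≗Q xs)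

countSubsets-∧ : (b : Bool) (Q : List A → Bool) (xs : List A) →
                 countSubsets (λ l → b ∧ Q l) xs ≡ (if b then countSubsets Q xs else 0)
countSubsets-∧ true  Q xs = ≡.refl
countSubsets-∧ false Q []       = ≡.refl
countSubsets-∧ false Q (x ∷ xs) = cong₂ _+_ (countSubsets-∧ false (Q ∘ (x ∷_)) xs) (countSubsets-∧ false Q xs)

countSubsets-map : (P : List B → Bool) (f : A → B) (xs : List A) →
                   countSubsets P (map f xs) ≡ countSubsets (P ∘ map f) xs
countSubsets-map P f []       = ≡.refl
countSubsets-map P f (x ∷ xs) = cong₂ _+_ (countSubsets-map (P ∘ (f x ∷_)) f xs) (countSubsets-map P f xs)

PermutationInvariant : (List A → Bool) → Set
PermutationInvariant P = ∀ {l l'} → l ↭ l' → P l ≡ P l'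

countSubsets-↭ : (P : List A → Bool) → PermutationInvariant P →
                 {xs ys : List A} → xs ↭ ys → countSubsets P xs ≡ countSubsets P ys
countSubsets-↭ P inv refl = ≡.refl
countSubsets-↭ P inv (prep x p) =
  cong₂ _+_ (countSubsets-↭ (P ∘ (x ∷_)) (inv ∘ prep x) p) (countSubsets-↭ P inv p)
countSubsets-↭ P inv (swap {xs} {ys} x y p) = begin
  (countSubsets (P ∘ (x ∷_) ∘ (y ∷_)) xs + countSubsets (P ∘ (x ∷_)) xs)
    + (countSubsets (P ∘ (y ∷_)) xs + countSubsets P xs)
    ≡⟨ +-interchange (countSubsets (P ∘ (x ∷_) ∘ (y ∷_)) xs) (countSubsets (P ∘ (x ∷_)) xs) _ _ ⟩
  (countSubsets (P ∘ (x ∷_) ∘ (y ∷_)) xs + countSubsets (P ∘ (y ∷_)) xs)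
    + (countSubsets (P ∘ (x ∷_)) xs + countSubsets P xs)
    ≡⟨ cong₂ _+_ (cong₂ _+_ xy≡yx (sub (y ∷_) (λ q → prep y q)))
                 (cong₂ _+_ (sub (x ∷_) (λ q → prep x q)) (countSubsets-↭ P inv p)) ⟩
  (countSubsets (P ∘ (y ∷_) ∘ (x ∷_)) ys + countSubsets (P ∘ (y ∷_)) ys)
    + (countSubsets (P ∘ (x ∷_)) ys + countSubsets P ys) ∎
  where
  sub : (f : List _ → List _) → (∀ {l l'} → l ↭ l' → f l ↭ f l') →
        countSubsets (P ∘ f) xs ≡ countSubsets (P ∘ f) ys
  sub f f⁺ = countSubsets-↭ (P ∘ f) (inv ∘ f⁺) p
  xy≡yx : countSubsets (P ∘ (x ∷_) ∘ (y ∷_)) xs ≡ countSubsets (P ∘ (y ∷_) ∘ (x ∷_)) ys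
  xy≡yx = ≡.trans (sub (λ l → x ∷ y ∷ l) (λ q → prep x (prep y q)))
                  (countSubsets-cong (λ l → inv (swap x y refl)) ys)
countSubsets-↭ P inv (trans p q) = ≡.trans (countSubsets-↭ P inv p) (countSubsets-↭ P inv q)


allB-∧ : (f g : A → Bool) (xs : List A) → allB (λ x → f x ∧ g x) xs ≡ allB f xs ∧ allB g xs
allB-∧ f g []       = ≡.refl
allB-∧ f g (x ∷ xs) =
  ≡.trans (cong ((f x ∧ g x) ∧_) (allB-∧ f g xs)) (∧-interchange (f x) (g x) (allB f xs) (allB g xs))

allB-map : (p : B → Bool) (f : A → B) (xs : List A) → allB p (map f xs) ≡ allB (p ∘ f) xs
allB-map p f []       = ≡.refl
allB-map p f (x ∷ xs) = cong (p (f x) ∧_) (allB-map p f xs)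

allB-cong : {p q : A → Bool} → (∀ x → p x ≡ q x) → ∀ xs → allB p xs ≡ allB q xs
allB-cong p≗q []       = ≡.refl
allB-cong p≗q (x ∷ xs) = cong₂ _∧_ (p≗q x) (allB-cong p≗q xs)

allB-true : {p : A → Bool} → (∀ x → p x ≡ true) → ∀ xs → allB p xs ≡ true
allB-true p≡true []       = ≡.refl
allB-true {p = p} p≡true (x ∷ xs) = ≡.trans (cong (_∧ allB p xs) (p≡true x)) (allB-true p≡true xs)

allB-cong-under : (f p q : A → Bool) → (∀ x → f x ≡ true → p x ≡ q x) →
                  ∀ xs → allB f xs ≡ true → allB p xs ≡ allB q xs
allB-cong-under f p q p≡q []       _  = ≡.refl
allB-cong-under f p q p≡q (x ∷ xs) fs =
  cong₂ _∧_ (p≡q x (∧-conicalˡ _ _ fs)) (allB-cong-under f p q p≡q xs (∧-conicalʳ _ _ fs))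

allB-↭ : (p : A → Bool) → PermutationInvariant (allB p)
allB-↭ p refl         = ≡.refl
allB-↭ p (prep x q)   = cong (p x ∧_) (allB-↭ p q)
allB-↭ p (swap x y q) = ≡.trans (cong (λ b → p x ∧ (p y ∧ b)) (allB-↭ p q)) (∧-swap (p x) (p y) _)
allB-↭ p (trans q r)  = ≡.trans (allB-↭ p q) (allB-↭ p r)

overlaps-sym : ∀ s p q → overlaps s p q ≡ overlaps s q p
overlaps-sym s (i , j) (i' , j') = cong₂ (λ a b → (a <ᵇ s) ∧ (b <ᵇ s)) (∣-∣-comm i i') (∣-∣-comm j j')

disjoint-↭ : ∀ s → PermutationInvariant (disjoint s)
disjoint-↭ s refl = ≡.refl
disjoint-↭ s (prep x q) = cong₂ _∧_ (allB-↭ _ q) (disjoint-↭ s q)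
disjoint-↭ s (swap {l} {l'} x y q) = begin
  (apart x y ∧ allB (apart x) l) ∧ (allB (apart y) l ∧ disjoint s l)
    ≡⟨ cong₂ (λ a b → (apart x y ∧ a) ∧ b) (allB-↭ _ q) (cong₂ _∧_ (allB-↭ _ q) (disjoint-↭ s q)) ⟩
  (apart x y ∧ allB (apart x) l') ∧ (allB (apart y) l' ∧ disjoint s l')
    ≡⟨ ∧-interchange (apart x y) _ _ _ ⟩
  (apart x y ∧ allB (apart y) l') ∧ (allB (apart x) l' ∧ disjoint s l')
    ≡⟨ cong (λ b → (not b ∧ allB (apart y) l') ∧ (allB (apart x) l' ∧ disjoint s l')) (overlaps-sym s x y) ⟩
  (apart y x ∧ allB (apart y) l') ∧ (allB (apart x) l' ∧ disjoint s l') ∎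
  where
  apart : Pos → Pos → Bool
  apart p q = not (overlaps s p q)
disjoint-↭ s (trans q r) = ≡.trans (disjoint-↭ s q) (disjoint-↭ s r)

-- On generating functions in t, delay 0 is multiplication by t.
delay : A → (ℕ → A) → ℕ → A
delay a f zero    = a
delay a f (suc k) = f k

delay-cong : (a : A) {f g : ℕ → A} → (∀ k → f k ≡ g k) → ∀ k → delay a f k ≡ delay a g k
delay-cong a f≗g zero    = ≡.refl
delay-cong a f≗g (suc k) = f≗g k

delay-const : (a : A) → ∀ k → delay a (λ _ → a) k ≡ a
delay-const a zero    = ≡.refl
delay-const a (suc k) = ≡.refl

placementIn : ℕ → ℕ → ℕ → (Pos → Bool) → ℕ → List Pos → Bool
placementIn n m s B k ps = (validPlacement n m s ps ∧ allB B ps) ∧ (length ps ≡ᵇ k)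

placementIn-↭ : ∀ n m s B k → PermutationInvariant (placementIn n m s B k)
placementIn-↭ n m s B k q =
  cong₂ _∧_ (cong₂ _∧_ (cong₂ _∧_ (allB-↭ _ q) (disjoint-↭ s q)) (allB-↭ B q)) (cong (_≡ᵇ k) (↭-length q))

avoiding : ℕ → Pos → (Pos → Bool) → (Pos → Bool)
avoiding s x B q = B q ∧ not (overlaps s x q)

placementIn-∷ : ∀ n m s B k x ps →
  placementIn n m s B (suc k) (x ∷ ps) ≡ (B x ∧ fits n m s x) ∧ placementIn n m s (avoiding s x B) k ps
placementIn-∷ n m s B k x ps = begin
  (((fits n m s x ∧ allB (fits n m s) ps) ∧ (allB (λ q → not (overlaps s x q)) ps ∧ disjoint s ps))
    ∧ (B x ∧ allB B ps)) ∧ (length ps ≡ᵇ k)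
    ≡⟨ reorder (fits n m s x) (allB (fits n m s) ps) (allB (λ q → not (overlaps s x q)) ps) (disjoint s ps)
               (B x) (allB B ps) (length ps ≡ᵇ k) ⟩
  (B x ∧ fits n m s x) ∧ (((allB (fits n m s) ps ∧ disjoint s ps)
    ∧ (allB B ps ∧ allB (λ q → not (overlaps s x q)) ps)) ∧ (length ps ≡ᵇ k))
    ≡⟨ cong (λ b → (B x ∧ fits n m s x) ∧ (((allB (fits n m s) ps ∧ disjoint s ps) ∧ b) ∧ (length ps ≡ᵇ k)))
            (sym (allB-∧ B _ ps)) ⟩
  (B x ∧ fits n m s x) ∧ placementIn n m s (avoiding s x B) k ps ∎
  where
  open ∨-∧-Solver
  reorder : ∀ a b c d e f g → (((a ∧ b) ∧ (c ∧ d)) ∧ (e ∧ f)) ∧ g ≡ (e ∧ a) ∧ (((b ∧ d) ∧ (f ∧ c)) ∧ g)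
  reorder = solve 7 (λ a b c d e f g →
    (((a :* b) :* (c :* d)) :* (e :* f)) :* g := (e :* a) :* (((b :* d) :* (f :* c)) :* g)) ≡.refl

placementIn-zero-∷ : ∀ n m s B x ps → placementIn n m s B zero (x ∷ ps) ≡ false
placementIn-zero-∷ n m s B x ps = ∧-zeroʳ _

countSubsets-placementIn-∷ : ∀ n m s B k x xs →
  countSubsets (placementIn n m s B k) (x ∷ xs)
    ≡ (if B x ∧ fits n m s x then delay 0 (λ k' → countSubsets (placementIn n m s (avoiding s x B) k') xs) k else 0)
      + countSubsets (placementIn n m s B k) xs
countSubsets-placementIn-∷ n m s B zero x xs = cong (_+ _) (begin
  countSubsets (λ ps → placementIn n m s B zero (x ∷ ps)) xs
    ≡⟨ countSubsets-cong (placementIn-zero-∷ n m s B x) xs ⟩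
  countSubsets (λ _ → false) xs
    ≡⟨ countSubsets-∧ false (λ _ → true) xs ⟩
  0
    ≡⟨ sym (if-eta (B x ∧ fits n m s x)) ⟩
  (if B x ∧ fits n m s x then 0 else 0) ∎)
countSubsets-placementIn-∷ n m s B (suc k) x xs = cong (_+ _)
  (≡.trans (countSubsets-cong (placementIn-∷ n m s B k x) xs) (countSubsets-∧ _ _ xs))

placementIn-cong : ∀ n m s {B B' : Pos → Bool} → (∀ q → fits n m s q ≡ true → B q ≡ B' q) →
                   ∀ k ps → placementIn n m s B k ps ≡ placementIn n m s B' k ps
placementIn-cong n m s {B} {B'} B≡B' k ps with allB (fits n m s) ps in all-fit
... | true  = cong (λ b → (disjoint s ps ∧ b) ∧ (length ps ≡ᵇ k))
                   (allB-cong-under (fits n m s) B B' B≡B' ps all-fit)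
... | false = ≡.refl

shiftRight : Pos → Pos
shiftRight (i , j) = (i , suc j)

<ᵇ-suc : ∀ a b → (a <ᵇ suc b) ≡ (a ≤ᵇ b)
<ᵇ-suc zero    b = ≡.refl
<ᵇ-suc (suc a) b = ≡.refl

fits-shiftRight : ∀ n m s q → fits n (suc m) s (shiftRight q) ≡ fits n m s q
fits-shiftRight n m s (i , j) = cong ((i + s ≤ᵇ n) ∧_) (<ᵇ-suc (j + s) m)

disjoint-shiftRight : ∀ s ps → disjoint s (map shiftRight ps) ≡ disjoint s ps
disjoint-shiftRight s []       = ≡.refl
disjoint-shiftRight s (p ∷ ps) =
  cong₂ _∧_ (allB-map (λ q → not (overlaps s (shiftRight p) q)) shiftRight ps) (disjoint-shiftRight s ps)

placementIn-shiftRight : ∀ n m s B k ps →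
  placementIn n (suc m) s B k (map shiftRight ps) ≡ placementIn n m s (B ∘ shiftRight) k ps
placementIn-shiftRight n m s B k ps = cong₂ _∧_
  (cong₂ _∧_ (cong₂ _∧_ fit (disjoint-shiftRight s ps)) (allB-map B shiftRight ps))
  (cong (_≡ᵇ k) (length-map shiftRight ps))
  where
  fit : allB (fits n (suc m) s) (map shiftRight ps) ≡ allB (fits n m s) ps
  fit = ≡.trans (allB-map _ shiftRight ps) (allB-cong (fits-shiftRight n m s) ps)


map-applyUpTo : (f : A → B) (g : ℕ → A) (n : ℕ) → map f (applyUpTo g n) ≡ applyUpTo (f ∘ g) n
map-applyUpTo f g zero    = ≡.refl
map-applyUpTo f g (suc n) = cong (f (g 0) ∷_) (map-applyUpTo f (g ∘ suc) n)

concatMap-∷-↭ : (f : A → B) (g : A → List B) (xs : List A) →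
                concatMap (λ x → f x ∷ g x) xs ↭ map f xs ++ concatMap g xs
concatMap-∷-↭ f g []       = ↭-refl
concatMap-∷-↭ f g (x ∷ xs) =
  ↭-prep (f x) (↭-trans (++⁺ˡ (g x) (concatMap-∷-↭ f g xs)) (shifts (g x) (map f xs)))

cells-suc-↭ : ∀ n m → cells n (suc m) ↭ map (_, 0) (upTo n) ++ map shiftRight (cells n m)
cells-suc-↭ n m =
  ↭-trans (concatMap-∷-↭ (_, 0) row (upTo n)) (↭-reflexive (cong (map (_, 0) (upTo n) ++_) rows≡))
  where
  row : ℕ → List Pos
  row i = map (i ,_) (applyUpTo suc m)
  rows≡ : concatMap row (upTo n) ≡ map shiftRight (cells n m)
  rows≡ = ≡.trans (cong concat (map-cong row≡ (upTo n)))
                  (sym (map-concatMap shiftRight (λ i → map (i ,_) (upTo m)) (upTo n)))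
    where
    row≡ : ∀ i → row i ≡ map shiftRight (map (i ,_) (upTo m))
    row≡ i = ≡.trans (map-applyUpTo (i ,_) suc m)
               (sym (≡.trans (cong (map shiftRight) (map-applyUpTo (i ,_) (λ j → j) m))
                             (map-applyUpTo shiftRight (i ,_) m)))


-- The transfer recursion
-- Corners that may still carry a square: c₀ in column 0, c₁ in column 1. A square with its corner in
-- column 0 conflicts with no corner beyond column 1.
Frontier : Set
Frontier = (ℕ → Bool) × (ℕ → Bool)

allowedAt : Frontier → Pos → Bool
allowedAt (c₀ , c₁) (i , zero)        = c₀ i
allowedAt (c₀ , c₁) (i , suc zero)    = c₁ i
allowedAt (c₀ , c₁) (i , suc (suc j)) = true

block : ℕ → Frontier → Frontier
block r (c₀ , c₁) = (λ i → c₀ i ∧ far i) , (λ i → c₁ i ∧ far i)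
  where
  far : ℕ → Bool
  far i = not (∣ r - i ∣ <ᵇ 2)

allowedAt-block : ∀ r F q → allowedAt (block r F) q ≡ avoiding 2 (r , 0) (allowedAt F) q
allowedAt-block r (c₀ , c₁) (i , zero)        = cong (λ b → c₀ i ∧ not b) (sym (∧-identityʳ _))
allowedAt-block r (c₀ , c₁) (i , suc zero)    = cong (λ b → c₁ i ∧ not b) (sym (∧-identityʳ _))
allowedAt-block r (c₀ , c₁) (i , suc (suc j)) = cong not (sym (∧-zeroʳ (∣ r - i ∣ <ᵇ 2)))

module ChooseCorners {A : Set} (0# : A) (_⊕_ : A → A → A) (shift : A → A) where

  chooseCorners : (ℕ → Bool) → List ℕ → Frontier → (Frontier → A) → A
  chooseCorners fit []       F K = K F
  chooseCorners fit (r ∷ rs) F K =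
    (if proj₁ F r ∧ fit r then shift (chooseCorners fit rs (block r F) K) else 0#)
      ⊕ chooseCorners fit rs F K

open ChooseCorners {ℕ → ℕ} (λ _ → 0) (λ f g k → f k + g k) (delay 0)
  renaming (chooseCorners to chooseCornersCount)

chooseCornersCount-cong : ∀ fit {K K' : Frontier → ℕ → ℕ} → (∀ F k → K F k ≡ K' F k) →
  ∀ rs F k → chooseCornersCount fit rs F K k ≡ chooseCornersCount fit rs F K' k
chooseCornersCount-cong fit K≗K' []       F k = K≗K' F k
chooseCornersCount-cong fit K≗K' (r ∷ rs) F k with proj₁ F r ∧ fit r
... | true  = cong₂ _+_ (delay-cong 0 (chooseCornersCount-cong fit K≗K' rs (block r F)) k)
                        (chooseCornersCount-cong fit K≗K' rs F k)
... | false = chooseCornersCount-cong fit K≗K' rs F k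

countSubsets-column : ∀ n m F k rs ys →
  countSubsets (placementIn n m 2 (allowedAt F) k) (map (_, 0) rs ++ ys)
    ≡ chooseCornersCount (λ r → fits n m 2 (r , 0)) rs F
                         (λ F' k' → countSubsets (placementIn n m 2 (allowedAt F') k') ys) k
countSubsets-column n m F k []       ys = ≡.refl
countSubsets-column n m F k (r ∷ rs) ys = begin
  countSubsets (placementIn n m 2 (allowedAt F) k) ((r , 0) ∷ map (_, 0) rs ++ ys)
    ≡⟨ countSubsets-placementIn-∷ n m 2 (allowedAt F) k (r , 0) (map (_, 0) rs ++ ys) ⟩
  (if c then delay 0 (λ k' → countSubsets (placementIn n m 2 (avoiding 2 (r , 0) (allowedAt F)) k') rest) k else 0)
    + countSubsets (placementIn n m 2 (allowedAt F) k) rest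
    ≡⟨ cong₂ _+_ (cong (λ x → if c then x else 0) (delay-cong 0 blocked k)) (countSubsets-column n m F k rs ys) ⟩
  (if c then delay 0 (chooseCornersCount fit rs (block r F) K) k else 0) + chooseCornersCount fit rs F K k
    ≡⟨ cong (_+ chooseCornersCount fit rs F K k)
            (sym (if-float (λ f → f k) c {delay 0 (chooseCornersCount fit rs (block r F) K)} {λ _ → 0})) ⟩
  chooseCornersCount fit (r ∷ rs) F K k ∎
  where
  fit : ℕ → Bool
  fit r = fits n m 2 (r , 0)
  c : Bool
  c = proj₁ F r ∧ fit r
  rest : List Pos
  rest = map (_, 0) rs ++ ys
  K : Frontier → ℕ → ℕ
  K F' k' = countSubsets (placementIn n m 2 (allowedAt F') k') ys
  blocked : ∀ k' → countSubsets (placementIn n m 2 (avoiding 2 (r , 0) (allowedAt F)) k') rest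
                   ≡ chooseCornersCount fit rs (block r F) K k'
  blocked k' = ≡.trans (countSubsets-cong (placementIn-cong n m 2 (λ q _ → sym (allowedAt-block r F q)) k') rest)
                       (countSubsets-column n m (block r F) k' rs ys)

free : ∀ {w} → Vec Bool w → ℕ → Bool
free []      i       = true
free (b ∷ v) zero    = b
free (b ∷ v) (suc i) = free v i

column : (ℕ → Bool) → (w : ℕ) → Vec Bool w
column c zero    = []
column c (suc w) = c 0 ∷ column (c ∘ suc) w

free-column : ∀ c {w i} → i < w → free (column c w) i ≡ c i
free-column c {suc w} {zero}  _       = ≡.refl
free-column c {suc w} {suc i} (s≤s i<w) = free-column (c ∘ suc) i<w

free-replicate : ∀ w i → free (replicate w true) i ≡ true
free-replicate zero    i       = ≡.refl
free-replicate (suc w) zero    = ≡.refl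
free-replicate (suc w) (suc i) = free-replicate w i

toFrontier : ∀ {w} → Vec Bool w → Frontier
toFrontier v = free v , λ _ → true

-- A state marks which corners of the first column are still free; rows ≥ w can never hold a corner.
transfer : (w m : ℕ) → Vec Bool w → ℕ → ℕ
transfer w zero    v k = if 0 ≡ᵇ k then 1 else 0
transfer w (suc m) v   =
  chooseCornersCount (λ r → fits (suc w) (suc m) 2 (r , 0)) (upTo (suc w)) (toFrontier v)
                     (λ F → transfer w m (column (proj₂ F) w))

fits⇒row< : ∀ w m i j → fits (suc w) m 2 (i , j) ≡ true → i < w
fits⇒row< w m i j fit =
  s≤s⁻¹ (subst (_≤ suc w) (+-comm i 2) (≤ᵇ⇒≤ (i + 2) (suc w) (subst T (sym (∧-conicalˡ _ _ fit)) tt)))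

allowedAt-shiftRight : ∀ w m F q → fits (suc w) m 2 q ≡ true →
  allowedAt F (shiftRight q) ≡ allowedAt (toFrontier (column (proj₂ F) w)) q
allowedAt-shiftRight w m F (i , zero)        fit = sym (free-column (proj₂ F) (fits⇒row< w m i 0 fit))
allowedAt-shiftRight w m F (i , suc zero)    fit = ≡.refl
allowedAt-shiftRight w m F (i , suc (suc j)) fit = ≡.refl

cells-zero : ∀ n → cells n 0 ≡ []
cells-zero n = go (upTo n)
  where
  go : (is : List ℕ) → concatMap (λ i → map (i ,_) (upTo 0)) is ≡ []
  go []       = ≡.refl
  go (i ∷ is) = go is

countSubsets-transfer : ∀ w m v k →
  countSubsets (placementIn (suc w) m 2 (allowedAt (toFrontier v)) k) (cells (suc w) m) ≡ transfer w m v k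
countSubsets-transfer w zero    v k =
  cong (countSubsets (placementIn (suc w) 0 2 (allowedAt (toFrontier v)) k)) (cells-zero (suc w))
countSubsets-transfer w (suc m) v k = begin
  countSubsets (placement (suc m) (toFrontier v) k) (cells (suc w) (suc m))
    ≡⟨ countSubsets-↭ _ (placementIn-↭ (suc w) (suc m) 2 _ k) (cells-suc-↭ (suc w) m) ⟩
  countSubsets (placement (suc m) (toFrontier v) k) (map (_, 0) (upTo (suc w)) ++ map shiftRight grid)
    ≡⟨ countSubsets-column (suc w) (suc m) (toFrontier v) k (upTo (suc w)) (map shiftRight grid) ⟩
  chooseCornersCount fit (upTo (suc w)) (toFrontier v)
                     (λ F k' → countSubsets (placement (suc m) F k') (map shiftRight grid)) k
    ≡⟨ chooseCornersCount-cong fit next (upTo (suc w)) (toFrontier v) k ⟩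
  transfer w (suc m) v k ∎
  where
  placement : ℕ → Frontier → ℕ → List Pos → Bool
  placement m F = placementIn (suc w) m 2 (allowedAt F)
  grid : List Pos
  grid = cells (suc w) m
  fit : ℕ → Bool
  fit r = fits (suc w) (suc m) 2 (r , 0)
  next : ∀ F k' → countSubsets (placement (suc m) F k') (map shiftRight grid) ≡ transfer w m (column (proj₂ F) w) k'
  next F k' = begin
    countSubsets (placement (suc m) F k') (map shiftRight grid)
      ≡⟨ countSubsets-map _ shiftRight grid ⟩
    countSubsets (placement (suc m) F k' ∘ map shiftRight) grid
      ≡⟨ countSubsets-cong (placementIn-shiftRight (suc w) m 2 (allowedAt F) k') grid ⟩
    countSubsets (placementIn (suc w) m 2 (allowedAt F ∘ shiftRight) k') grid
      ≡⟨ countSubsets-cong (placementIn-cong (suc w) m 2 (allowedAt-shiftRight w m F) k') grid ⟩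
    countSubsets (placement m (toFrontier (column (proj₂ F) w)) k') grid
      ≡⟨ countSubsets-transfer w m (column (proj₂ F) w) k' ⟩
    transfer w m (column (proj₂ F) w) k' ∎

Tcount≡transfer : ∀ w m k → Tcount (suc w) m 2 k ≡ transfer w m (replicate w true) k
Tcount≡transfer w m k = begin
  Tcount (suc w) m 2 k
    ≡⟨ length-filter-sublists _ (cells (suc w) m) ⟩
  countSubsets (λ ps → validPlacement (suc w) m 2 ps ∧ (length ps ≡ᵇ k)) (cells (suc w) m)
    ≡⟨ countSubsets-cong (λ ps → cong (_∧ (length ps ≡ᵇ k)) (sym (everywhereAllowed ps))) (cells (suc w) m) ⟩
  countSubsets (placementIn (suc w) m 2 (allowedAt (toFrontier (replicate w true))) k) (cells (suc w) m)
    ≡⟨ countSubsets-transfer w m (replicate w true) k ⟩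
  transfer w m (replicate w true) k ∎
  where
  allowedEverywhere : ∀ q → allowedAt (toFrontier (replicate w true)) q ≡ true
  allowedEverywhere (i , zero)        = free-replicate w i
  allowedEverywhere (i , suc zero)    = ≡.refl
  allowedEverywhere (i , suc (suc j)) = ≡.refl
  everywhereAllowed : ∀ ps → validPlacement (suc w) m 2 ps ∧ allB (allowedAt (toFrontier (replicate w true))) ps
                             ≡ validPlacement (suc w) m 2 ps
  everywhereAllowed ps =
    ≡.trans (cong (validPlacement (suc w) m 2 ps ∧_) (allB-true allowedEverywhere ps)) (∧-identityʳ _)


Poly : Set
Poly = List ℤ

infixl 6 _+ₚ_
_+ₚ_ : Poly → Poly → Poly
[]      +ₚ q       = q
(a ∷ p) +ₚ []      = a ∷ p
(a ∷ p) +ₚ (b ∷ q) = (a +ℤ b) ∷ (p +ₚ q)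

_·ₚ_ : ℤ → Poly → Poly
c ·ₚ p = map (c *ℤ_) p

-- The polynomial Σ pᵢ tⁱ acts on a sequence f by (p ⋆ f) k = Σ_{i ≤ k} pᵢ f (k − i).
_⋆_ : Poly → (ℕ → ℤ) → ℕ → ℤ
([]      ⋆ f) k = + 0
((c ∷ p) ⋆ f) k = c *ℤ f k +ℤ delay (+ 0) (p ⋆ f) k

delay-+ : (f g : ℕ → ℤ) → ∀ k → delay (+ 0) (λ i → f i +ℤ g i) k ≡ delay (+ 0) f k +ℤ delay (+ 0) g k
delay-+ f g zero    = ≡.refl
delay-+ f g (suc k) = ≡.refl

delay-* : ∀ c (f : ℕ → ℤ) k → delay (+ 0) (λ i → c *ℤ f i) k ≡ c *ℤ delay (+ 0) f k
delay-* c f zero    = sym (ℤ.*-zeroʳ c)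
delay-* c f (suc k) = ≡.refl

⋆-+ₚ : ∀ p q f k → ((p +ₚ q) ⋆ f) k ≡ (p ⋆ f) k +ℤ (q ⋆ f) k
⋆-+ₚ []      q       f k = sym (ℤ.+-identityˡ _)
⋆-+ₚ (a ∷ p) []      f k = sym (ℤ.+-identityʳ _)
⋆-+ₚ (a ∷ p) (b ∷ q) f k = begin
  (a +ℤ b) *ℤ f k +ℤ delay (+ 0) ((p +ₚ q) ⋆ f) k
    ≡⟨ cong₂ _+ℤ_ (ℤ.*-distribʳ-+ (f k) a b)
                  (≡.trans (delay-cong (+ 0) (⋆-+ₚ p q f) k) (delay-+ (p ⋆ f) (q ⋆ f) k)) ⟩
  (a *ℤ f k +ℤ b *ℤ f k) +ℤ (delay (+ 0) (p ⋆ f) k +ℤ delay (+ 0) (q ⋆ f) k)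
    ≡⟨ +ℤ-interchange (a *ℤ f k) (b *ℤ f k) _ _ ⟩
  (a *ℤ f k +ℤ delay (+ 0) (p ⋆ f) k) +ℤ (b *ℤ f k +ℤ delay (+ 0) (q ⋆ f) k) ∎

⋆-·ₚ : ∀ c p f k → ((c ·ₚ p) ⋆ f) k ≡ c *ℤ (p ⋆ f) k
⋆-·ₚ c []      f k = sym (ℤ.*-zeroʳ c)
⋆-·ₚ c (a ∷ p) f k = begin
  c *ℤ a *ℤ f k +ℤ delay (+ 0) ((c ·ₚ p) ⋆ f) k
    ≡⟨ cong₂ _+ℤ_ (ℤ.*-assoc c a (f k)) (≡.trans (delay-cong (+ 0) (⋆-·ₚ c p f) k) (delay-* c (p ⋆ f) k)) ⟩
  c *ℤ (a *ℤ f k) +ℤ c *ℤ delay (+ 0) (p ⋆ f) k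
    ≡⟨ sym (ℤ.*-distribˡ-+ c _ _) ⟩
  c *ℤ (a *ℤ f k +ℤ delay (+ 0) (p ⋆ f) k) ∎

⋆-t : ∀ p f k → ((+ 0 ∷ p) ⋆ f) k ≡ delay (+ 0) (p ⋆ f) k
⋆-t p f k = ℤ.+-identityˡ _

⋆-one : ∀ f k → ((+ 1 ∷ []) ⋆ f) k ≡ f k
⋆-one f k =
  ≡.trans (cong (_+ℤ_ (+ 1 *ℤ f k)) (delay-const (+ 0) k)) (≡.trans (ℤ.+-identityʳ _) (ℤ.*-identityˡ (f k)))

nullₚ : Poly → Bool
nullₚ []            = true
nullₚ (+ zero ∷ p)  = nullₚ p
nullₚ (_ ∷ _)       = false

⋆-null : ∀ p f k → nullₚ p ≡ true → (p ⋆ f) k ≡ + 0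
⋆-null []           f k _    = ≡.refl
⋆-null (+ zero ∷ p) f k null = ≡.trans (ℤ.+-identityˡ _)
  (≡.trans (delay-cong (+ 0) (λ i → ⋆-null p f i null) k) (delay-const (+ 0) k))

data Table (A : Set) : ℕ → Set where
  leaf : A → Table A zero
  node : ∀ {n} → Table A n → Table A n → Table A (suc n)

tconst : ∀ {n} → A → Table A n
tconst {n = zero}  a = leaf a
tconst {n = suc n} a = node (tconst a) (tconst a)

tmap : ∀ {n} → (A → B) → Table A n → Table B n
tmap f (leaf a)   = leaf (f a)
tmap f (node l r) = node (tmap f l) (tmap f r)

tzipWith : ∀ {n} → (A → B → C) → Table A n → Table B n → Table C n
tzipWith f (leaf a)     (leaf b)     = leaf (f a b)
tzipWith f (node l₁ r₁) (node l₂ r₂) = node (tzipWith f l₁ l₂) (tzipWith f r₁ r₂)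

tall : ∀ {n} → (A → Bool) → Table A n → Bool
tall p (leaf a)   = p a
tall p (node l r) = tall p l ∧ tall p r

-- A ℤ[t]-linear combination of 2ʷ sequences indexed by Vec Bool w.
Lin : ℕ → Set
Lin w = Table Poly w

unitAt : ∀ {w} → Vec Bool w → Lin w
unitAt []          = leaf (+ 1 ∷ [])
unitAt (true ∷ v)  = node (unitAt v) (tconst [])
unitAt (false ∷ v) = node (tconst []) (unitAt v)

evalLin : ∀ {w} → Lin w → (Vec Bool w → ℕ → ℤ) → ℕ → ℤ
evalLin (leaf p)   ρ k = (p ⋆ ρ []) k
evalLin (node l r) ρ k = evalLin l (ρ ∘ (true ∷_)) k +ℤ evalLin r (ρ ∘ (false ∷_)) k

evalLin-tconst : ∀ {w} ρ k → evalLin {w} (tconst []) ρ k ≡ + 0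
evalLin-tconst {zero}  ρ k = ≡.refl
evalLin-tconst {suc w} ρ k = cong₂ _+ℤ_ (evalLin-tconst (ρ ∘ (true ∷_)) k) (evalLin-tconst (ρ ∘ (false ∷_)) k)

evalLin-+ : ∀ {w} (D E : Lin w) ρ k → evalLin (tzipWith _+ₚ_ D E) ρ k ≡ evalLin D ρ k +ℤ evalLin E ρ k
evalLin-+ (leaf p)     (leaf q)     ρ k = ⋆-+ₚ p q (ρ []) k
evalLin-+ (node l₁ r₁) (node l₂ r₂) ρ k =
  ≡.trans (cong₂ _+ℤ_ (evalLin-+ l₁ l₂ (ρ ∘ (true ∷_)) k) (evalLin-+ r₁ r₂ (ρ ∘ (false ∷_)) k))
          (+ℤ-interchange (evalLin l₁ (ρ ∘ (true ∷_)) k) (evalLin l₂ (ρ ∘ (true ∷_)) k) _ _)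

evalLin-· : ∀ {w} c (D : Lin w) ρ k → evalLin (tmap (c ·ₚ_) D) ρ k ≡ c *ℤ evalLin D ρ k
evalLin-· c (leaf p)   ρ k = ⋆-·ₚ c p (ρ []) k
evalLin-· c (node l r) ρ k =
  ≡.trans (cong₂ _+ℤ_ (evalLin-· c l (ρ ∘ (true ∷_)) k) (evalLin-· c r (ρ ∘ (false ∷_)) k))
          (sym (ℤ.*-distribˡ-+ c _ _))

evalLin-t : ∀ {w} (D : Lin w) ρ k → evalLin (tmap (+ 0 ∷_) D) ρ k ≡ delay (+ 0) (evalLin D ρ) k
evalLin-t (leaf p)   ρ k = ⋆-t p (ρ []) k
evalLin-t (node l r) ρ k =
  ≡.trans (cong₂ _+ℤ_ (evalLin-t l (ρ ∘ (true ∷_)) k) (evalLin-t r (ρ ∘ (false ∷_)) k))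
          (sym (delay-+ (evalLin l (ρ ∘ (true ∷_))) (evalLin r (ρ ∘ (false ∷_))) k))

evalLin-unitAt : ∀ {w} (v : Vec Bool w) ρ k → evalLin (unitAt v) ρ k ≡ ρ v k
evalLin-unitAt []          ρ k = ⋆-one (ρ []) k
evalLin-unitAt (true ∷ v)  ρ k =
  ≡.trans (cong₂ _+ℤ_ (evalLin-unitAt v (ρ ∘ (true ∷_)) k) (evalLin-tconst (ρ ∘ (false ∷_)) k)) (ℤ.+-identityʳ _)
evalLin-unitAt (false ∷ v) ρ k =
  ≡.trans (cong₂ _+ℤ_ (evalLin-tconst (ρ ∘ (true ∷_)) k) (evalLin-unitAt v (ρ ∘ (false ∷_)) k)) (ℤ.+-identityˡ _)

evalLin-null : ∀ {w} (D : Lin w) ρ k → tall nullₚ D ≡ true → evalLin D ρ k ≡ + 0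
evalLin-null (leaf p)   ρ k null = ⋆-null p (ρ []) k null
evalLin-null (node l r) ρ k null = cong₂ _+ℤ_
  (evalLin-null l (ρ ∘ (true ∷_)) k (∧-conicalˡ _ _ null)) (evalLin-null r (ρ ∘ (false ∷_)) k (∧-conicalʳ _ _ null))


delay-pos : (f : ℕ → ℕ) → ∀ k → delay (+ 0) (+_ ∘ f) k ≡ + delay 0 f k
delay-pos f zero    = ≡.refl
delay-pos f (suc k) = ≡.refl

module ChooseCornersHomomorphism {A : Set} (0# : A) (_⊕_ : A → A → A) (shift : A → A)
  (h : A → ℕ → ℤ) (h-0# : ∀ k → h 0# k ≡ + 0) (h-⊕ : ∀ a b k → h (a ⊕ b) k ≡ h a k +ℤ h b k)
  (h-shift : ∀ a k → h (shift a) k ≡ delay (+ 0) (h a) k) where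

  open ChooseCorners 0# _⊕_ shift

  chooseCorners-homomorphism : ∀ {fit fit'} → fit ≗ fit' → {K : Frontier → A} {K' : Frontier → ℕ → ℕ} →
    (∀ F k → h (K F) k ≡ + K' F k) →
    ∀ rs F k → h (chooseCorners fit rs F K) k ≡ + chooseCornersCount fit' rs F K' k
  chooseCorners-homomorphism fit≗fit' K≈K' []       F k = K≈K' F k
  chooseCorners-homomorphism {fit} {fit'} fit≗fit' {K} {K'} K≈K' (r ∷ rs) F k
    rewrite h-⊕ (if proj₁ F r ∧ fit r then shift (chooseCorners fit rs (block r F) K) else 0#)
                (chooseCorners fit rs F K) k
          | fit≗fit' r
    with proj₁ F r ∧ fit' r
  ... | true  = begin
    h (shift (chooseCorners fit rs (block r F) K)) k +ℤ h (chooseCorners fit rs F K) k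
      ≡⟨ cong₂ _+ℤ_ (≡.trans (h-shift _ k)
                             (delay-cong (+ 0) (chooseCorners-homomorphism fit≗fit' K≈K' rs (block r F)) k))
                   (chooseCorners-homomorphism fit≗fit' K≈K' rs F k) ⟩
    delay (+ 0) (+_ ∘ chooseCornersCount fit' rs (block r F) K') k +ℤ + chooseCornersCount fit' rs F K' k
      ≡⟨ cong₂ _+ℤ_ (delay-pos (chooseCornersCount fit' rs (block r F) K') k) ≡.refl ⟩
    + delay 0 (chooseCornersCount fit' rs (block r F) K') k +ℤ + chooseCornersCount fit' rs F K' k
      ≡⟨ sym (ℤ.pos-+ (delay 0 (chooseCornersCount fit' rs (block r F) K') k) _) ⟩
    + (delay 0 (chooseCornersCount fit' rs (block r F) K') k + chooseCornersCount fit' rs F K' k) ∎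
  ... | false = ≡.trans (cong₂ _+ℤ_ (h-0# k) (chooseCorners-homomorphism fit≗fit' K≈K' rs F k)) (ℤ.+-identityˡ _)

module Symbolic (w : ℕ) where

  open ChooseCorners {Lin w} (tconst []) (tzipWith _+ₚ_) (tmap (+ 0 ∷_))

  symbolicTransfer : ℕ → Vec Bool w → Lin w
  symbolicTransfer zero    v = unitAt v
  symbolicTransfer (suc j) v =
    chooseCorners (λ r → r + 2 ≤ᵇ suc w) (upTo (suc w)) (toFrontier v)
                  (λ F → symbolicTransfer j (column (proj₂ F) w))

  symbolicTransfer-sound : ∀ m j v k →
    evalLin (symbolicTransfer j v) (λ u i → + transfer w (suc m) u i) k ≡ + transfer w (j + suc m) v k
  symbolicTransfer-sound m zero    v k = evalLin-unitAt v _ k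
  symbolicTransfer-sound m (suc j) v k =
    chooseCorners-homomorphism fit≗ (λ F → symbolicTransfer-sound m j (column (proj₂ F) w))
                               (upTo (suc w)) (toFrontier v) k
    where
    ρ : Vec Bool w → ℕ → ℤ
    ρ u i = + transfer w (suc m) u i
    open ChooseCornersHomomorphism (tconst []) (tzipWith _+ₚ_) (tmap (+ 0 ∷_)) (λ D → evalLin D ρ)
           (evalLin-tconst ρ) (λ D E → evalLin-+ D E ρ) (λ D → evalLin-t D ρ)
    fit≗ : ∀ r → (r + 2 ≤ᵇ suc w) ≡ fits (suc w) (suc (j + suc m)) 2 (r , 0)
    fit≗ r rewrite +-suc j m = sym (∧-identityʳ _)

open Symbolic using (symbolicTransfer; symbolicTransfer-sound)

Terms : Set
Terms = List ((ℕ × ℕ) × ℤ)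

shiftedSum : Terms → PS → PS
shiftedSum []                   g m k = + 0
shiftedSum (((a , b) , c) ∷ cs) g m k =
  (if (a ≤ᵇ m) ∧ (b ≤ᵇ k) then c *ℤ g (m ∸ a) (k ∸ b) else + 0) +ℤ shiftedSum cs g m k

shifted : ∀ {w} → ℕ → Lin w → Lin w
shifted zero    D = D
shifted (suc b) D = tmap (+ 0 ∷_) (shifted b D)

evalLin-shifted : ∀ {w} b (D : Lin w) ρ k → evalLin (shifted b D) ρ k ≡ (if b ≤ᵇ k then evalLin D ρ (k ∸ b) else + 0)
evalLin-shifted zero    D ρ k       = ≡.refl
evalLin-shifted (suc b) D ρ zero    = evalLin-t (shifted b D) ρ zero
evalLin-shifted (suc b) D ρ (suc k) = begin
  evalLin (tmap (+ 0 ∷_) (shifted b D)) ρ (suc k)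
    ≡⟨ evalLin-t (shifted b D) ρ (suc k) ⟩
  evalLin (shifted b D) ρ k
    ≡⟨ evalLin-shifted b D ρ k ⟩
  (if b ≤ᵇ k then evalLin D ρ (k ∸ b) else + 0)
    ≡⟨ cong (λ x → if x then evalLin D ρ (k ∸ b) else + 0) (sym (<ᵇ-suc b k)) ⟩
  (if suc b ≤ᵇ suc k then evalLin D ρ (k ∸ b) else + 0) ∎

-- The denominator applied symbolically: the term c zᵃ tᵇ contributes c tᵇ times d − a unfolded transfer
-- steps from the all-free state. At the state sequences of length m + 1 this evaluates to the
-- coefficient of z^(d+1+m) in denominator × series (annihilator-sound).
annihilator : (w d : ℕ) → Terms → Lin w
annihilator w d []                   = tconst []
annihilator w d (((a , b) , c) ∷ cs) =
  tzipWith _+ₚ_ (tmap (c ·ₚ_) (shifted b (symbolicTransfer w (d ∸ a) (replicate w true)))) (annihilator w d cs)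

module _ (w m : ℕ) where

  private
    full : Vec Bool w
    full = replicate w true
    ρ : Vec Bool w → ℕ → ℤ
    ρ u i = + transfer w (suc m) u i

  annihilator-term : ∀ d a b c → a ≤ d → ∀ k →
    evalLin (tmap (c ·ₚ_) (shifted b (symbolicTransfer w (d ∸ a) full))) ρ k
      ≡ (if (a ≤ᵇ d + suc m) ∧ (b ≤ᵇ k) then c *ℤ + transfer w (d + suc m ∸ a) full (k ∸ b) else + 0)
  annihilator-term d a b c a≤d k
    rewrite evalLin-· c (shifted b (symbolicTransfer w (d ∸ a) full)) ρ k
          | evalLin-shifted b (symbolicTransfer w (d ∸ a) full) ρ k
          | Equivalence.to T-≡ (≤⇒≤ᵇ (≤-trans a≤d (m≤m+n d (suc m))))
          | +-∸-comm (suc m) a≤d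
    with b ≤ᵇ k
  ... | true  = cong (c *ℤ_) (symbolicTransfer-sound w m (d ∸ a) full (k ∸ b))
  ... | false = ℤ.*-zeroʳ c

  annihilator-sound : ∀ d (cs : Terms) → All (λ t → proj₁ (proj₁ t) ≤ d) cs → ∀ k →
    evalLin (annihilator w d cs) ρ k ≡ shiftedSum cs (λ n i → + transfer w n full i) (d + suc m) k
  annihilator-sound d []                   []         k = evalLin-tconst ρ k
  annihilator-sound d (((a , b) , c) ∷ cs) (a≤d ∷ ≤d) k =
    ≡.trans (evalLin-+ (tmap (c ·ₚ_) (shifted b (symbolicTransfer w (d ∸ a) full))) (annihilator w d cs) ρ k)
            (cong₂ _+ℤ_ (annihilator-term d a b c a≤d k) (annihilator-sound d cs ≤d k))


sumTo-cong : ∀ n {f g : ℕ → ℤ} → (∀ i → f i ≡ g i) → sumTo n f ≡ sumTo n g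
sumTo-cong zero    f≗g = f≗g 0
sumTo-cong (suc n) f≗g = cong₂ _+ℤ_ (sumTo-cong n f≗g) (f≗g (suc n))

sumTo-+ : ∀ n (f g : ℕ → ℤ) → sumTo n (λ i → f i +ℤ g i) ≡ sumTo n f +ℤ sumTo n g
sumTo-+ zero    f g = ≡.refl
sumTo-+ (suc n) f g =
  ≡.trans (cong (_+ℤ (f (suc n) +ℤ g (suc n))) (sumTo-+ n f g)) (+ℤ-interchange (sumTo n f) (sumTo n g) _ _)

sumTo-zero : ∀ n → sumTo n (λ _ → + 0) ≡ + 0
sumTo-zero zero    = ≡.refl
sumTo-zero (suc n) = cong (_+ℤ + 0) (sumTo-zero n)

sumTo-if : ∀ n p (f : ℕ → ℤ) → sumTo n (λ i → if p then f i else + 0) ≡ (if p then sumTo n f else + 0)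
sumTo-if n true  f = ≡.refl
sumTo-if n false f = sumTo-zero n

sumTo-suc : ∀ n (f : ℕ → ℤ) → sumTo (suc n) f ≡ f 0 +ℤ sumTo n (f ∘ suc)
sumTo-suc zero    f = ≡.refl
sumTo-suc (suc n) f = ≡.trans (cong (_+ℤ f (suc (suc n))) (sumTo-suc n f)) (ℤ.+-assoc (f 0) _ _)

sumTo-indicator : ∀ n j (f : ℕ → ℤ) → sumTo n (λ i → if j ≡ᵇ i then f i else + 0) ≡ (if j ≤ᵇ n then f j else + 0)
sumTo-indicator zero    zero    f = ≡.refl
sumTo-indicator zero    (suc j) f = ≡.refl
sumTo-indicator (suc n) zero    f = begin
  sumTo (suc n) (λ i → if 0 ≡ᵇ i then f i else + 0)  ≡⟨ sumTo-suc n _ ⟩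
  f 0 +ℤ sumTo n (λ _ → + 0)                          ≡⟨ cong (_+ℤ_ (f 0)) (sumTo-zero n) ⟩
  f 0 +ℤ + 0                                          ≡⟨ ℤ.+-identityʳ (f 0) ⟩
  f 0                                                ∎
sumTo-indicator (suc n) (suc j) f = begin
  sumTo (suc n) (λ i → if suc j ≡ᵇ i then f i else + 0)
    ≡⟨ sumTo-suc n _ ⟩
  + 0 +ℤ sumTo n (λ i → if j ≡ᵇ i then f (suc i) else + 0)
    ≡⟨ ℤ.+-identityˡ _ ⟩
  sumTo n (λ i → if j ≡ᵇ i then f (suc i) else + 0)
    ≡⟨ sumTo-indicator n j (f ∘ suc) ⟩
  (if j ≤ᵇ n then f (suc j) else + 0)
    ≡⟨ cong (λ b → if b then f (suc j) else + 0) (sym (<ᵇ-suc j n)) ⟩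
  (if suc j ≤ᵇ suc n then f (suc j) else + 0) ∎

⊛-congʳ : ∀ f {g h : PS} → (∀ a b → g a b ≡ h a b) → ∀ m k → (f ⊛ g) m k ≡ (f ⊛ h) m k
⊛-congʳ f g≗h m k = sumTo-cong m (λ a → sumTo-cong k (λ b → cong (f a b *ℤ_) (g≗h (m ∸ a) (k ∸ b))))

⊛-+ : ∀ (f h g : PS) m k → ((λ a b → f a b +ℤ h a b) ⊛ g) m k ≡ (f ⊛ g) m k +ℤ (h ⊛ g) m k
⊛-+ f h g m k = ≡.trans (sumTo-cong m split) (sumTo-+ m _ _)
  where
  term : PS → ℕ → ℕ → ℤ
  term F a b = F a b *ℤ g (m ∸ a) (k ∸ b)
  split : ∀ a → sumTo k (λ b → (f a b +ℤ h a b) *ℤ g (m ∸ a) (k ∸ b)) ≡ sumTo k (term f a) +ℤ sumTo k (term h a)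
  split a = ≡.trans (sumTo-cong k (λ b → ℤ.*-distribʳ-+ (g (m ∸ a) (k ∸ b)) (f a b) (h a b))) (sumTo-+ k _ _)

monomial-⊛ : ∀ a₀ b₀ c (g : PS) m k →
  ((λ a b → if (a₀ ≡ᵇ a) ∧ (b₀ ≡ᵇ b) then c else + 0) ⊛ g) m k
    ≡ (if (a₀ ≤ᵇ m) ∧ (b₀ ≤ᵇ k) then c *ℤ g (m ∸ a₀) (k ∸ b₀) else + 0)
monomial-⊛ a₀ b₀ c g m k = begin
  sumTo m (λ a → sumTo k (λ b → (if (a₀ ≡ᵇ a) ∧ (b₀ ≡ᵇ b) then c else + 0) *ℤ g (m ∸ a) (k ∸ b)))
    ≡⟨ sumTo-cong m sumOverB ⟩
  sumTo m (λ a → if a₀ ≡ᵇ a then (if b₀ ≤ᵇ k then c *ℤ g (m ∸ a) (k ∸ b₀) else + 0) else + 0)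
    ≡⟨ sumTo-indicator m a₀ _ ⟩
  (if a₀ ≤ᵇ m then (if b₀ ≤ᵇ k then c *ℤ g (m ∸ a₀) (k ∸ b₀) else + 0) else + 0)
    ≡⟨ sym (if-∧ (a₀ ≤ᵇ m)) ⟩
  (if (a₀ ≤ᵇ m) ∧ (b₀ ≤ᵇ k) then c *ℤ g (m ∸ a₀) (k ∸ b₀) else + 0) ∎
  where
  sumOverB : ∀ a → sumTo k (λ b → (if (a₀ ≡ᵇ a) ∧ (b₀ ≡ᵇ b) then c else + 0) *ℤ g (m ∸ a) (k ∸ b))
                 ≡ (if a₀ ≡ᵇ a then (if b₀ ≤ᵇ k then c *ℤ g (m ∸ a) (k ∸ b₀) else + 0) else + 0)
  sumOverB a = begin
    sumTo k (λ b → (if (a₀ ≡ᵇ a) ∧ (b₀ ≡ᵇ b) then c else + 0) *ℤ g (m ∸ a) (k ∸ b))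
      ≡⟨ sumTo-cong k (λ b → ≡.trans (if-float (_*ℤ g (m ∸ a) (k ∸ b)) ((a₀ ≡ᵇ a) ∧ (b₀ ≡ᵇ b))) (if-∧ (a₀ ≡ᵇ a))) ⟩
    sumTo k (λ b → if a₀ ≡ᵇ a then (if b₀ ≡ᵇ b then c *ℤ g (m ∸ a) (k ∸ b) else + 0) else + 0)
      ≡⟨ sumTo-if k (a₀ ≡ᵇ a) (λ b → if b₀ ≡ᵇ b then c *ℤ g (m ∸ a) (k ∸ b) else + 0) ⟩
    (if a₀ ≡ᵇ a then sumTo k (λ b → if b₀ ≡ᵇ b then c *ℤ g (m ∸ a) (k ∸ b) else + 0) else + 0)
      ≡⟨ cong (λ x → if a₀ ≡ᵇ a then x else + 0) (sumTo-indicator k b₀ _) ⟩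
    (if a₀ ≡ᵇ a then (if b₀ ≤ᵇ k then c *ℤ g (m ∸ a) (k ∸ b₀) else + 0) else + 0) ∎

poly-⊛ : ∀ cs g m k → (poly cs ⊛ g) m k ≡ shiftedSum cs g m k
poly-⊛ []                     g m k = ≡.trans (sumTo-cong m (λ _ → sumTo-zero k)) (sumTo-zero m)
poly-⊛ (((a₀ , b₀) , c) ∷ cs) g m k =
  ≡.trans (⊛-+ (λ a b → if (a₀ ≡ᵇ a) ∧ (b₀ ≡ᵇ b) then c else + 0) (poly cs) g m k)
          (cong₂ _+ℤ_ (monomial-⊛ a₀ b₀ c g m k) (poly-⊛ cs g m k))


agreeAfter : ∀ K {f g : ℕ → ℤ} → (∀ (i : Fin K) → f (toℕ i) ≡ g (toℕ i)) → (∀ j → f (K + j) ≡ g (K + j)) →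
             ∀ k → f k ≡ g k
agreeAfter zero    below above k       = above k
agreeAfter (suc K) below above zero    = below Fin.zero
agreeAfter (suc K) below above (suc k) = agreeAfter K (λ i → below (Fin.suc i)) above k

agreeBelow? : ∀ K (f g : ℕ → ℤ) → Dec (∀ (i : Fin K) → f (toℕ i) ≡ g (toℕ i))
agreeBelow? K f g = all? (λ i → f (toℕ i) ≟ g (toℕ i))

denomTerms : Terms
denomTerms = ((0 , 0) , + 1) ∷ ((1 , 0) , -[1+ 0 ]) ∷ ((1 , 1) , -[1+ 0 ])
           ∷ ((2 , 1) , -[1+ 2 ]) ∷ ((2 , 2) , -[1+ 3 ]) ∷ ((3 , 2) , -[1+ 0 ])
           ∷ ((3 , 3) , + 3) ∷ ((4 , 4) , + 3) ∷ []

transferSeries : PS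
transferSeries m k = + transfer 4 m (replicate 4 true) k

denomTimesSeries : PS
denomTimesSeries = shiftedSum denomTerms transferSeries

denom-annihilates : tall nullₚ (annihilator 4 4 denomTerms) ≡ true
denom-annihilates = ≡.refl

denom-recurrence : ∀ m k → denomTimesSeries (5 + m) k ≡ + 0
denom-recurrence m k = begin
  denomTimesSeries (4 + suc m) k             ≡⟨ sym (annihilator-sound 4 m 4 denomTerms bounded k) ⟩
  evalLin (annihilator 4 4 denomTerms) ρ k   ≡⟨ evalLin-null (annihilator 4 4 denomTerms) ρ k denom-annihilates ⟩
  + 0                                        ∎
  where
  ρ : Vec Bool 4 → ℕ → ℤ
  ρ u i = + transfer 4 (suc m) u i
  bounded : All (λ t → proj₁ (proj₁ t) ≤ 4) denomTerms
  bounded = from-yes (All.all? (λ t → proj₁ (proj₁ t) ≤? 4) denomTerms)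

-- Beyond k = 6 both sides evaluate to 0 symbolically in k: at most four squares fit into 5 × 4.
denomTimesSeries≡numer : ∀ m k → denomTimesSeries m k ≡ numer m k
denomTimesSeries≡numer 0 = agreeAfter 7 (from-yes (agreeBelow? 7 (denomTimesSeries 0) (numer 0))) (λ _ → ≡.refl)
denomTimesSeries≡numer 1 = agreeAfter 7 (from-yes (agreeBelow? 7 (denomTimesSeries 1) (numer 1))) (λ _ → ≡.refl)
denomTimesSeries≡numer 2 = agreeAfter 7 (from-yes (agreeBelow? 7 (denomTimesSeries 2) (numer 2))) (λ _ → ≡.refl)
denomTimesSeries≡numer 3 = agreeAfter 7 (from-yes (agreeBelow? 7 (denomTimesSeries 3) (numer 3))) (λ _ → ≡.refl)
denomTimesSeries≡numer 4 = agreeAfter 7 (from-yes (agreeBelow? 7 (denomTimesSeries 4) (numer 4))) (λ _ → ≡.refl)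
denomTimesSeries≡numer (suc (suc (suc (suc (suc m))))) = denom-recurrence m

mainTheorem9 : (m k : ℕ) → (denom ⊛ F52) m k ≡ numer m k
mainTheorem9 m k = begin
  (denom ⊛ F52) m k                       ≡⟨ ⊛-congʳ denom (λ a b → cong +_ (Tcount≡transfer 4 a b)) m k ⟩
  (poly denomTerms ⊛ transferSeries) m k  ≡⟨ poly-⊛ denomTerms transferSeries m k ⟩
  denomTimesSeries m k                    ≡⟨ denomTimesSeries≡numer m k ⟩
  numer m k                               ∎
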